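{- The set of simple permutations in $\operatorname{Av}(2143,3142,246135)$ equals the set of simple permutations in $\operatorname{Av}(2143,3142,3412)$.
   Context: $\operatorname{Av}(\Pi)$ denotes the set of all permutations avoiding every pattern in $\Pi$ (i.e. having no subsequence order-isomorphic to any element of $\Pi$). An interval of a permutation $\pi$ is a nonempty contiguous set of positions $\{i,\dots,j\}$ whose set of values $\{\pi(i),\dots,\pi(j)\}$ is also a contiguous set of integers. A permutation of length $n$ is simple if its only intervals have length $1$ or $n$. -}

module Defs where

open import Data.Nat using (ℕ; _+_; _∸_; _≤_; _<_)
open import Data.Fin using (Fin; toℕ)
open import Data.Fin.Patterns
open import Data.Product using (Σ; ∃; ∃-syntax; _×_; _,_)
open import Data.Sum using (_⊎_)
open import Data.List using (List; []; _∷_)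
open import Data.List.Relation.Unary.All using (All)
open import Function.Bundles using (_↔_; Inverse; _⇔_)
open import Relation.Nullary using (¬_)
open import Relation.Binary.PropositionalEquality using (_≡_)

-- A permutation of length n: a bijection of Fin n = {0,…,n-1}
-- (positions ↦ values, 0-based).
Perm : ℕ → Set
Perm n = Fin n ↔ Fin n

_⟨_⟩ : ∀ {n} → Perm n → Fin n → ℕ
π ⟨ i ⟩ = toℕ (Inverse.to π i)

-- A pattern: length k together with its one-line notation (values as ℕ,
-- only their relative order matters).
record Pattern : Set where
  constructor pat
  field
    len : ℕ
    val : Fin len → ℕ
open Pattern public

Contains : ∀ {n} → Perm n → Pattern → Set
Contains {n} π p =
  Σ (Fin (len p) → Fin n) λ f →
    (∀ a b → toℕ a < toℕ b → toℕ (f a) < toℕ (f b)) ×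
    (∀ a b → (π ⟨ f a ⟩ < π ⟨ f b ⟩) ⇔ (val p a < val p b))

Avoids : ∀ {n} → Perm n → Pattern → Set
Avoids π p = ¬ Contains π p

AvoidsAll : ∀ {n} → Perm n → List Pattern → Set
AvoidsAll π Π = All (Avoids π) Π

IsInterval : ∀ {n} → Perm n → ℕ → ℕ → Set
IsInterval {n} π i j =
  i ≤ j × j < n ×
  ∃[ a ] ∀ (v : ℕ) →
    (∃[ p ] (i ≤ toℕ p × toℕ p ≤ j × π ⟨ p ⟩ ≡ v)) ⇔ (a ≤ v × v ≤ a + (j ∸ i))

Simple : ∀ {n} → Perm n → Set
Simple {n} π = ∀ i j → IsInterval π i j → (j ∸ i) + 1 ≡ 1 ⊎ (j ∸ i) + 1 ≡ n

-- Patterns in one-line notation (1-based values as in the paper).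
p2143 : Pattern
p2143 = pat 4 λ { 0F → 2 ; 1F → 1 ; 2F → 4 ; 3F → 3 }

p3142 : Pattern
p3142 = pat 4 λ { 0F → 3 ; 1F → 1 ; 2F → 4 ; 3F → 2 }

p3412 : Pattern
p3412 = pat 4 λ { 0F → 3 ; 1F → 4 ; 2F → 1 ; 3F → 2 }

p246135 : Pattern
p246135 = pat 6 λ { 0F → 2 ; 1F → 4 ; 2F → 6 ; 3F → 1 ; 4F → 3 ; 5F → 5 }

module Submission where

-- As 246135 contains 3412 (its factor 4613), it remains to show
-- that a simple π avoiding 2143, 3142, 246135 avoids 3412.  Avoiding 2143 and
-- 3142 means π has no dominated descents.  Given an occurrence of 3412, take
-- one, a b c d, with the highest "4" and then the lowest "1".  A value in
-- (σ c, σ d) before a together with a value in (σ a, σ b) after d would give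
-- 246135.  If there is no such value before a, a chain of extremal choices
-- (RightWindow) yields a window: a block of at least two, but not all,
-- positions carried onto a block of consecutive values, i.e. a nontrivial
-- interval; if there is none after d, the same applies to the
-- reverse-complement (ReverseComplement).

open import Defs
open import Data.Nat
  using (ℕ; zero; suc; _+_; _∸_; _≤_; _<_; z≤n; s≤s; pred; _≤?_; _<?_; s≤s⁻¹; >-nonZero; _<ᵇ_)
open import Data.Bool using (T)
open import Data.Nat.Properties
open import Data.Fin using (Fin; toℕ; zero; suc; opposite; fromℕ<; inject₁)
  renaming (_<_ to _<ᶠ_; _≤_ to _≤ᶠ_)
open import Data.Fin.Properties
  using (toℕ-injective; toℕ<n; any?; opposite-prop; opposite-involutive; toℕ-fromℕ<)
open import Data.Fin.Patterns
open import Data.Product using (∃-syntax; _×_; _,_; proj₁; proj₂)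
open import Data.Sum using (_⊎_; inj₁; inj₂)
open import Data.Empty using (⊥; ⊥-elim)
open import Data.List using ([]; _∷_)
open import Data.List.Relation.Unary.All using ([]; _∷_)
open import Relation.Nullary using (¬_; Dec; yes; no)
open import Relation.Nullary.Decidable using (_×-dec_; map′)
open import Relation.Unary using (Decidable)
open import Relation.Binary.Definitions using (Tri; tri<; tri≈; tri>)
open import Relation.Binary.PropositionalEquality
open import Function.Bundles using (Inverse; _⇔_; mk⇔; Equivalence)
open import Function.Base using (_∘_; case_of_)
open import Function.Construct.Composition using (_⇔-∘_)
open import Function.Construct.Symmetry using (⇔-sym)
open import Algebra.Properties.CommutativeMonoid.Sum +-0-commutativeMonoid
  using (sum; sum-cong-≗; sum-replicate-zero; ∑-permute)

module Extremum (R : ℕ → ℕ → Set) (R-refl : ∀ {x} → R x x)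
                (R-trans : ∀ {x y z} → R x y → R y z → R x z)
                (R-total : ∀ x y → R x y ⊎ R y x) where

  record Extremal {n} (f : Fin n → ℕ) (Q : Fin n → Set) : Set where
    field
      point : Fin n
      holds : Q point
      bound : ∀ y → Q y → R (f point) (f y)

  extremal : ∀ {n} (f : Fin n → ℕ) {Q : Fin n → Set} → Decidable Q →
             (x : Fin n) → Q x → Extremal f Q
  extremal {suc n} f {Q} Q? x qx with any? (Q? ∘ suc)
  ... | no noneInTail = record { point = zero ; holds = onlyZero x qx ; bound = zeroBest }
    where
    onlyZero : ∀ y → Q y → Q zero
    onlyZero zero q = q
    onlyZero (suc y) q = ⊥-elim (noneInTail (y , q))
    zeroBest : ∀ y → Q y → R (f zero) (f y)
    zeroBest zero _ = R-refl
    zeroBest (suc y) q = ⊥-elim (noneInTail (y , q))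
  ... | yes (y , qy) = compareHead (Q? zero)
    where
    tailBest : Extremal (f ∘ suc) (Q ∘ suc)
    tailBest = extremal (f ∘ suc) (Q? ∘ suc) y qy
    open Extremal tailBest renaming (point to t; holds to qt; bound to t-best)

    takeTail : (∀ y → Q y → R (f (suc t)) (f y)) → Extremal f Q
    takeTail best = record { point = suc t ; holds = qt ; bound = best }

    compareHead : Dec (Q zero) → Extremal f Q
    compareHead (no ¬q0) = takeTail λ { zero q → ⊥-elim (¬q0 q) ; (suc y) q → t-best y q }
    compareHead (yes q0) with R-total (f zero) (f (suc t))
    ... | inj₁ r = record { point = zero ; holds = q0
                          ; bound = λ { zero _ → R-refl ; (suc y) q → R-trans r (t-best y q) } }
    ... | inj₂ r = takeTail λ { zero _ → r ; (suc y) q → t-best y q }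

open Extremum _≤_ ≤-refl ≤-trans ≤-total
  using () renaming (Extremal to Minimal; extremal to argmin)
open Extremum (λ x y → y ≤ x) ≤-refl (λ p q → ≤-trans q p) (λ x y → ≤-total y x)
  using () renaming (Extremal to Maximal; extremal to argmax)

increasing : ∀ {k} (h : Fin (suc k) → ℕ) → (∀ (i : Fin k) → h (inject₁ i) < h (suc i)) →
             ∀ a b → a <ᶠ b → h a < h b
increasing {suc k} h step zero (suc zero) _ = step zero
increasing {suc k} h step zero (suc (suc b)) _ =
  <-trans (step zero) (increasing (h ∘ suc) (step ∘ suc) zero (suc b) (s≤s z≤n))
increasing {suc k} h step (suc a) (suc b) a<b =
  increasing (h ∘ suc) (step ∘ suc) a b (s≤s⁻¹ a<b)

record Is3412 {n} (σ : Fin n → ℕ) (a b c d : Fin n) : Set where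
  constructor occ3412
  field
    a<b : a <ᶠ b
    b<c : b <ᶠ c
    c<d : c <ᶠ d
    σc<σd : σ c < σ d
    σd<σa : σ d < σ a
    σa<σb : σ a < σ b

-- Occurrences are decidable, so extremal ones can be chosen.
is3412? : ∀ {n} (σ : Fin n → ℕ) a b c d → Dec (Is3412 σ a b c d)
is3412? σ a b c d =
  map′ (λ (p , q , r , s , t , u) → occ3412 p q r s t u)
       (λ o → let open Is3412 o in a<b , b<c , c<d , σc<σd , σd<σa , σa<σb)
       ((toℕ a <? toℕ b) ×-dec (toℕ b <? toℕ c) ×-dec (toℕ c <? toℕ d) ×-dec
        (σ c <? σ d) ×-dec (σ d <? σ a) ×-dec (σ a <? σ b))

-- σ has no two descents (i, j) and (k, l) at increasing positions with the
-- second dominating the first (σ i < σ k and σ j < σ l).  Such a pair is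
-- exactly an occurrence of 2143 or of 3142.
NoDominatedDescents : ∀ {n} → (Fin n → ℕ) → Set
NoDominatedDescents σ = ∀ i j k l → i <ᶠ j → j <ᶠ k → k <ᶠ l →
  σ j < σ i → σ l < σ k → σ i < σ k → σ j < σ l → ⊥

-- For a permutation this is a nontrivial interval.
record Window {n} (σ : Fin n → ℕ) : Set where
  field
    first last low high : ℕ
    first<last : first < last
    proper : 0 < first ⊎ suc last < n
    last<n : last < n
    low≤high : low ≤ high
    high<n : high < n
    exact : ∀ p → (first ≤ toℕ p × toℕ p ≤ last) ⇔ (low ≤ σ p × σ p ≤ high)

-- Then σ has a
-- window, namely the positions (β, γ] carried onto the values [σ c, σ u₂)
-- for the extremal positions β, γ, u₂ chosen below.
module RightWindow {n} (σ : Fin n → ℕ) (σ-injective : ∀ {x y} → σ x ≡ σ y → x ≡ y)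
  (σ<n : ∀ x → σ x < n) (noDD : NoDominatedDescents σ)
  (a b c d : Fin n) (abcd : Is3412 σ a b c d)
  (c-lowest : ∀ i k l → Is3412 σ i b k l → σ c ≤ σ k)
  (noLeftFill : ∀ x → x <ᶠ a → σ c < σ x → σ x < σ d → ⊥) where

  open Is3412 abcd

  distinctValues : ∀ {x y} → x <ᶠ y → σ x ≢ σ y
  distinctValues x<y eq = <-irrefl (cong toℕ (σ-injective eq)) x<y

  distinctPositions : ∀ {x y} → σ x < σ y → toℕ x ≢ toℕ y
  distinctPositions lt eq = <-irrefl (cong σ (toℕ-injective eq)) lt

  UpToB : Fin n → Set
  UpToB x = x ≤ᶠ b × σ c ≤ σ x

  a∈UpToB : UpToB a
  a∈UpToB = <⇒≤ a<b , <⇒≤ (<-trans σc<σd σd<σa)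

  open Minimal (argmin σ {UpToB} (λ x → (toℕ x ≤? toℕ b) ×-dec (σ c ≤? σ x)) a a∈UpToB)
    renaming (point to u; holds to u∈UpToB; bound to u-least)

  σu≤σa : σ u ≤ σ a
  σu≤σa = u-least a a∈UpToB

  u<b : u <ᶠ b
  u<b = ≤∧≢⇒< (proj₁ u∈UpToB) (distinctPositions (≤-<-trans σu≤σa σa<σb))

  -- Up to b, every value ≥ σ c exceeds σ d: a value in (σ c, σ d) before a
  -- is excluded by hypothesis, and one between a and b would make a x b d a
  -- pair of dominated descents.
  aboveD : ∀ x → x ≤ᶠ b → σ c ≤ σ x → σ d < σ x
  aboveD x x≤b σc≤σx with <-cmp (σ x) (σ d)
  ... | tri> _ _ σd<σx = σd<σx
  ... | tri≈ _ eq _ = ⊥-elim (distinctValues (≤-<-trans x≤b (<-trans b<c c<d)) eq)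
  ... | tri< σx<σd _ _ with <-cmp (toℕ x) (toℕ a)
  ...   | tri< x<a _ _ = ⊥-elim (noLeftFill x x<a σc<σx σx<σd)
    where
    σc<σx : σ c < σ x
    σc<σx = ≤∧≢⇒< σc≤σx (distinctValues (≤-<-trans x≤b b<c) ∘ sym)
  ...   | tri≈ _ x≡a _ =
    ⊥-elim (<-asym σd<σa (subst (λ z → σ z < σ d) (toℕ-injective x≡a) σx<σd))
  ...   | tri> _ _ a<x = ⊥-elim (noDD a x b d a<x x<b (<-trans b<c c<d)
                           (<-trans σx<σd σd<σa) (<-trans σd<σa σa<σb) σa<σb σx<σd)
    where
    x<b : x <ᶠ b
    x<b = ≤∧≢⇒< x≤b (distinctPositions (<-trans σx<σd (<-trans σd<σa σa<σb)))

  σd<σu : σ d < σ u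
  σd<σu = aboveD u (proj₁ u∈UpToB) (proj₂ u∈UpToB)

  BeforeC : Fin n → Set
  BeforeC x = x <ᶠ c × σ u ≤ σ x

  b∈BeforeC : BeforeC b
  b∈BeforeC = b<c , ≤-trans σu≤σa (<⇒≤ σa<σb)

  open Maximal (argmax toℕ {BeforeC} (λ x → (toℕ x <? toℕ c) ×-dec (σ u ≤? σ x)) b b∈BeforeC)
    renaming (point to β; holds to β∈BeforeC; bound to β-last)

  b≤β : b ≤ᶠ β
  b≤β = β-last b b∈BeforeC

  σu<σβ : σ u < σ β
  σu<σβ = ≤∧≢⇒< (proj₂ β∈BeforeC) (distinctValues (<-≤-trans u<b b≤β))

  -- aboveD extends up to β: a value in [σ c, σ d] between b and β would make
  -- u x β d a pair of dominated descents.
  aboveD′ : ∀ x → x ≤ᶠ β → σ c ≤ σ x → σ d < σ x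
  aboveD′ x x≤β σc≤σx with toℕ x ≤? toℕ b
  ... | yes x≤b = aboveD x x≤b σc≤σx
  ... | no x≰b with m≤n⇒m<n∨m≡n x≤β
  ...   | inj₂ x≡β =
    subst (λ z → σ d < σ z) (sym (toℕ-injective x≡β)) (<-trans σd<σu σu<σβ)
  ...   | inj₁ x<β with <-cmp (σ x) (σ d)
  ...     | tri> _ _ σd<σx = σd<σx
  ...     | tri≈ _ eq _ = ⊥-elim (distinctValues (<-trans x<β (<-trans (proj₁ β∈BeforeC) c<d)) eq)
  ...     | tri< σx<σd _ _ = ⊥-elim (noDD u x β d (<-trans u<b (≰⇒> x≰b)) x<β
                               (<-trans (proj₁ β∈BeforeC) c<d) (<-trans σx<σd σd<σu)
                               (<-trans σd<σu σu<σβ) σu<σβ σx<σd)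

  UpToβ : Fin n → Set
  UpToβ x = x ≤ᶠ β × σ c ≤ σ x

  u∈UpToβ : UpToβ u
  u∈UpToβ = ≤-trans (proj₁ u∈UpToB) b≤β , proj₂ u∈UpToB

  open Minimal (argmin σ {UpToβ} (λ x → (toℕ x ≤? toℕ β) ×-dec (σ c ≤? σ x)) u u∈UpToβ)
    renaming (point to u₂; holds to u₂∈UpToβ; bound to u₂-least)

  σc<σu₂ : σ c < σ u₂
  σc<σu₂ = <-trans σc<σd (aboveD′ u₂ (proj₁ u₂∈UpToβ) (proj₂ u₂∈UpToβ))

  Between : Fin n → Set
  Between x = σ c ≤ σ x × σ x < σ u₂

  d∈Between : Between d
  d∈Between = <⇒≤ σc<σd , aboveD′ u₂ (proj₁ u₂∈UpToβ) (proj₂ u₂∈UpToβ)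

  open Maximal (argmax toℕ {Between} (λ x → (σ c ≤? σ x) ×-dec (σ x <? σ u₂)) d d∈Between)
    renaming (point to γ; holds to γ∈Between; bound to γ-last)

  c<γ : c <ᶠ γ
  c<γ = <-≤-trans c<d (γ-last d d∈Between)

  σγ<σa : σ γ < σ a
  σγ<σa = <-≤-trans (proj₂ γ∈Between) (≤-trans (u₂-least u u∈UpToβ) σu≤σa)

  -- A value below σ c strictly between b and γ would be the "1" of an
  -- occurrence a b p l of 3412 (with l = d or l = γ).
  lowerOne : ∀ p → b <ᶠ p → p <ᶠ γ → σ p < σ c → ∃[ l ] Is3412 σ a b p l
  lowerOne p b<p p<γ σp<σc = case <-cmp (toℕ p) (toℕ d) of λ
    { (tri< p<d _ _) → d , occ3412 a<b b<p p<d (<-trans σp<σc σc<σd) σd<σa σa<σb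
    ; (tri≈ _ p≡d _) → ⊥-elim (distinctPositions (<-trans σp<σc σc<σd) p≡d)
    ; (tri> _ _ _) → γ , occ3412 a<b b<p p<γ (<-≤-trans σp<σc (proj₁ γ∈Between)) σγ<σa σa<σb
    }

  notBelowC : ∀ p → β <ᶠ p → p <ᶠ γ → σ c ≤ σ p
  notBelowC p β<p p<γ = ≮⇒≥ λ σp<σc →
    let (l , o) = lowerOne p (≤-<-trans b≤β β<p) p<γ σp<σc in <⇒≱ σp<σc (c-lowest a p l o)

  -- A value above σ u₂ strictly between β and c would make u u₂ β p a pair
  -- of dominated descents (by the extremality of u, β and u₂).
  notAboveU₂BeforeC : ∀ p → β <ᶠ p → p <ᶠ c → σ u₂ < σ p → ⊥
  notAboveU₂BeforeC p β<p p<c σu₂<σp =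
    noDD u u₂ β p (<-trans u<b b<u₂) u₂<β β<p σu₂<σu (<-trans σp<σu σu<σβ) σu<σβ σu₂<σp
    where
    σp<σu : σ p < σ u
    σp<σu = ≰⇒> λ σu≤σp → <⇒≱ β<p (β-last p (p<c , σu≤σp))
    σu₂<σu : σ u₂ < σ u
    σu₂<σu = <-trans σu₂<σp σp<σu
    b<u₂ : b <ᶠ u₂
    b<u₂ = ≰⇒> λ u₂≤b → <⇒≱ σu₂<σu (u-least u₂ (u₂≤b , proj₂ u₂∈UpToβ))
    u₂<β : u₂ <ᶠ β
    u₂<β = ≤∧≢⇒< (proj₁ u₂∈UpToβ) (distinctPositions (<-trans σu₂<σu σu<σβ))

  belowU₂ : ∀ p → β <ᶠ p → p <ᶠ γ → σ p < σ u₂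
  belowU₂ p β<p p<γ = case <-cmp (σ p) (σ u₂) of λ
    { (tri< σp<σu₂ _ _) → σp<σu₂
    ; (tri≈ _ eq _) → ⊥-elim (distinctValues (≤-<-trans (proj₁ u₂∈UpToβ) β<p) (sym eq))
    ; (tri> _ _ σu₂<σp) → ⊥-elim (notAboveU₂ σu₂<σp (<-cmp (toℕ p) (toℕ c)))
    }
    where
    σc<σγ : σ c < σ γ
    σc<σγ = ≤∧≢⇒< (proj₁ γ∈Between) (distinctValues c<γ)

    -- σ u₂ < σ p fails: before c by notAboveU₂BeforeC, at c as σ c < σ u₂,
    -- and after c since u₂ c p γ would be a pair of dominated descents
    notAboveU₂ : σ u₂ < σ p → Tri (p <ᶠ c) (toℕ p ≡ toℕ c) (c <ᶠ p) → ⊥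
    notAboveU₂ σu₂<σp (tri< p<c _ _) = notAboveU₂BeforeC p β<p p<c σu₂<σp
    notAboveU₂ σu₂<σp (tri≈ _ p≡c _) =
      <-asym σc<σu₂ (subst (λ z → σ u₂ < σ z) (toℕ-injective p≡c) σu₂<σp)
    notAboveU₂ σu₂<σp (tri> _ _ c<p) =
      noDD u₂ c p γ (≤-<-trans (proj₁ u₂∈UpToβ) (proj₁ β∈BeforeC)) c<p p<γ σc<σu₂
           (<-trans (proj₂ γ∈Between) σu₂<σp) σu₂<σp σc<σγ

  inside : ∀ p → β <ᶠ p → p ≤ᶠ γ → Between p
  inside p β<p p≤γ = case m≤n⇒m<n∨m≡n p≤γ of λ
    { (inj₁ p<γ) → notBelowC p β<p p<γ , belowU₂ p β<p p<γ
    ; (inj₂ p≡γ) → subst Between (sym (toℕ-injective p≡γ)) γ∈Between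
    }

  afterβ : ∀ p → Between p → β <ᶠ p
  afterβ p (σc≤σp , σp<σu₂) = ≰⇒> λ p≤β → <⇒≱ σp<σu₂ (u₂-least p (p≤β , σc≤σp))

  window : Window σ
  window = record
    { first = suc (toℕ β) ; last = toℕ γ ; low = σ c ; high = pred (σ u₂)
    ; first<last = ≤-<-trans (proj₁ β∈BeforeC) c<γ
    ; proper = inj₁ (s≤s z≤n)
    ; last<n = toℕ<n γ
    ; low≤high = <⇒≤pred σc<σu₂
    ; high<n = ≤-<-trans pred[n]≤n (σ<n u₂)
    ; exact = λ p → mk⇔
        (λ (β<p , p≤γ) → let (σc≤σp , σp<σu₂) = inside p β<p p≤γ in σc≤σp , <⇒≤pred σp<σu₂)
        (λ (σc≤σp , σp≤high) → let p∈Between = (σc≤σp , below σp≤high) in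
                               afterβ p p∈Between , γ-last p p∈Between)
    }
    where
    below : ∀ {v} → v ≤ pred (σ u₂) → v < σ u₂
    below = m≤pred[n]⇒suc[m]≤n ⦃ >-nonZero (≤-<-trans z≤n σc<σu₂) ⦄

≤-complement : ∀ {m x y} → y ≤ m → x ≤ m ∸ y → y ≤ m ∸ x
≤-complement {m} {x} y≤m x≤m∸y = subst (_≤ m ∸ x) (m∸[m∸n]≡n y≤m) (∸-monoʳ-≤ m x≤m∸y)

complement-≤ : ∀ {m x y} → x ≤ m → m ∸ x ≤ y → m ∸ y ≤ x
complement-≤ {m} {x} {y} x≤m m∸x≤y = subst (m ∸ y ≤_) (m∸[m∸n]≡n x≤m) (∸-monoʳ-≤ m m∸x≤y)

complement-range : ∀ {m x lo hi} → x ≤ m → lo ≤ m → hi ≤ m →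
                   (m ∸ hi ≤ x × x ≤ m ∸ lo) ⇔ (lo ≤ m ∸ x × m ∸ x ≤ hi)
complement-range x≤m lo≤m hi≤m =
  mk⇔ (λ (l , h) → ≤-complement lo≤m h , complement-≤ hi≤m l)
      (λ (l , h) → complement-≤ x≤m h , ≤-complement x≤m l)

-- This reduces
-- the case "no y after d" to the case "no x before a" of RightWindow.
module ReverseComplement {m} (σ : Fin (suc m) → ℕ)
  (σ-injective : ∀ {x y} → σ x ≡ σ y → x ≡ y) (σ<n : ∀ x → σ x < suc m) where

  τ : Fin (suc m) → ℕ
  τ p = m ∸ σ (opposite p)

  σ≤m : ∀ x → σ x ≤ m
  σ≤m x = s≤s⁻¹ (σ<n x)

  toℕ≤m : ∀ (x : Fin (suc m)) → toℕ x ≤ m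
  toℕ≤m x = s≤s⁻¹ (toℕ<n x)

  τ-opposite : ∀ x → τ (opposite x) ≡ m ∸ σ x
  τ-opposite x = cong (λ z → m ∸ σ z) (opposite-involutive x)

  opposite-< : ∀ (x y : Fin (suc m)) → x <ᶠ y → opposite y <ᶠ opposite x
  opposite-< x y x<y =
    subst₂ _<_ (sym (opposite-prop y)) (sym (opposite-prop x)) (∸-monoʳ-< x<y (toℕ≤m y))

  τ-reflects : ∀ x y → τ x < τ y → σ (opposite y) < σ (opposite x)
  τ-reflects _ _ = ∸-cancelʳ-<

  τ-reverses : ∀ {x y} → σ x < σ y → τ (opposite y) < τ (opposite x)
  τ-reverses {x} {y} σx<σy =
    subst₂ _<_ (sym (τ-opposite y)) (sym (τ-opposite x)) (∸-monoʳ-< σx<σy (σ≤m y))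

  τ-injective : ∀ {x y} → τ x ≡ τ y → x ≡ y
  τ-injective {x} {y} eq = begin
    x                       ≡⟨ opposite-involutive x ⟨
    opposite (opposite x)   ≡⟨ cong opposite (σ-injective (∸-cancelˡ-≡ (σ≤m _) (σ≤m _) eq)) ⟩
    opposite (opposite y)   ≡⟨ opposite-involutive y ⟩
    y                       ∎
    where open ≡-Reasoning

  τ<n : ∀ x → τ x < suc m
  τ<n x = s≤s (m∸n≤m m (σ (opposite x)))

  τ-noDD : NoDominatedDescents σ → NoDominatedDescents τ
  τ-noDD noDD i j k l i<j j<k k<l τj<τi τl<τk τi<τk τj<τl =
    noDD (opposite l) (opposite k) (opposite j) (opposite i)
         (opposite-< k l k<l) (opposite-< j k j<k) (opposite-< i j i<j)
         (τ-reflects l k τl<τk) (τ-reflects j i τj<τi) (τ-reflects j l τj<τl) (τ-reflects i k τi<τk)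

  σ-3412 : ∀ a b c d → Is3412 σ a b c d →
           Is3412 τ (opposite d) (opposite c) (opposite b) (opposite a)
  σ-3412 a b c d o = let open Is3412 o in
    occ3412 (opposite-< c d c<d) (opposite-< b c b<c) (opposite-< a b a<b)
            (τ-reverses σa<σb) (τ-reverses σd<σa) (τ-reverses σc<σd)

  τ-3412 : ∀ a b c d → Is3412 τ a b c d →
           Is3412 σ (opposite d) (opposite c) (opposite b) (opposite a)
  τ-3412 a b c d o = let open Is3412 o in
    occ3412 (opposite-< c d c<d) (opposite-< b c b<c) (opposite-< a b a<b)
            (τ-reflects a b σa<σb) (τ-reflects d a σd<σa) (τ-reflects c d σc<σd)

  windowBack : Window τ → Window σ
  windowBack w = record
    { first = m ∸ last ; last = m ∸ first ; low = m ∸ high ; high = m ∸ low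
    ; first<last = ∸-monoʳ-< first<last last≤m
    ; proper = properBack proper
    ; last<n = s≤s (m∸n≤m m first)
    ; low≤high = ∸-monoʳ-≤ m low≤high
    ; high<n = s≤s (m∸n≤m m low)
    ; exact = λ q → ⇔-sym (complement-range (σ≤m q) low≤m high≤m)
                    ⇔-∘ (flipped q
                    ⇔-∘ complement-range (toℕ≤m q) (≤-trans (<⇒≤ first<last) last≤m) last≤m)
    }
    where
    open Window w
    last≤m : last ≤ m
    last≤m = s≤s⁻¹ last<n
    high≤m : high ≤ m
    high≤m = s≤s⁻¹ high<n
    low≤m : low ≤ m
    low≤m = ≤-trans low≤high high≤m

    properBack : 0 < first ⊎ suc last < suc m → 0 < m ∸ last ⊎ suc (m ∸ first) < suc m
    properBack (inj₁ 0<first) = inj₂ (s≤s (∸-monoʳ-< 0<first (≤-trans (<⇒≤ first<last) last≤m)))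
    properBack (inj₂ last<m) = inj₁ (m<n⇒0<n∸m (s≤s⁻¹ last<m))

    flipped : ∀ q → (first ≤ m ∸ toℕ q × m ∸ toℕ q ≤ last) ⇔ (low ≤ m ∸ σ q × m ∸ σ q ≤ high)
    flipped q = subst₂ (λ s t → (first ≤ s × s ≤ last) ⇔ (low ≤ t × t ≤ high))
                       (opposite-prop q) (τ-opposite q) (exact (opposite q))

  leftWindow : NoDominatedDescents σ → ∀ a b c d → Is3412 σ a b c d →
    (∀ i j l → Is3412 σ i j c l → σ j ≤ σ b) →
    (∀ y → d <ᶠ y → σ a < σ y → σ y < σ b → ⊥) → Window σ
  leftWindow noDD a b c d abcd b-highest noRightFill = windowBack (RightWindow.window
    τ τ-injective τ<n (τ-noDD noDD) (opposite d) (opposite c) (opposite b) (opposite a)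
    (σ-3412 a b c d abcd) c-lowest noLeftFill)
    where
    c-lowest : ∀ i k l → Is3412 τ i (opposite c) k l → τ (opposite b) ≤ τ k
    c-lowest i k l o = subst (_≤ τ k) (sym (τ-opposite b)) (∸-monoʳ-≤ m σk≤σb)
      where
      σk≤σb : σ (opposite k) ≤ σ b
      σk≤σb = b-highest (opposite l) (opposite k) (opposite i)
                (subst (λ z → Is3412 σ (opposite l) (opposite k) z (opposite i))
                       (opposite-involutive c) (τ-3412 i (opposite c) k l o))

    noLeftFill : ∀ x → x <ᶠ opposite d → τ (opposite b) < τ x → τ x < τ (opposite a) → ⊥
    noLeftFill x x<d′ τb<τx τx<τa = noRightFill (opposite x)
      (subst (λ z → z <ᶠ opposite x) (opposite-involutive d) (opposite-< x (opposite d) x<d′))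
      (subst (λ z → σ z < σ (opposite x)) (opposite-involutive a) (τ-reflects x (opposite a) τx<τa))
      (subst (λ z → σ (opposite x) < σ z) (opposite-involutive b) (τ-reflects (opposite b) x τb<τx))

indicator : ∀ {P : Set} → Dec P → ℕ
indicator (yes _) = 1
indicator (no _) = 0

indicator-⇔ : ∀ {P Q : Set} (p : Dec P) (q : Dec Q) → P ⇔ Q → indicator p ≡ indicator q
indicator-⇔ (yes _) (yes _) _ = refl
indicator-⇔ (no _) (no _) _ = refl
indicator-⇔ (yes x) (no ¬y) P⇔Q = ⊥-elim (¬y (Equivalence.to P⇔Q x))
indicator-⇔ (no ¬x) (yes y) P⇔Q = ⊥-elim (¬x (Equivalence.from P⇔Q y))

indicator-yes : ∀ {P : Set} (p : Dec P) → P → indicator p ≡ 1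
indicator-yes (yes _) _ = refl
indicator-yes (no ¬x) x = ⊥-elim (¬x x)

indicator-no : ∀ {P : Set} (p : Dec P) → ¬ P → indicator p ≡ 0
indicator-no (yes x) ¬x = ⊥-elim (¬x x)
indicator-no (no _) _ = refl

inRange? : ∀ lo hi v → Dec (lo ≤ v × v ≤ hi)
inRange? lo hi v = (lo ≤? v) ×-dec (v ≤? hi)

countRange : ∀ m lo hi → lo ≤ hi → hi < m →
             sum {m} (λ v → indicator (inRange? lo hi (toℕ v))) ≡ suc hi ∸ lo
countRange (suc m) zero zero _ _ =
  cong₂ _+_ (indicator-yes (inRange? 0 0 0) (z≤n , z≤n))
            (trans (sum-cong-≗ outside) (sum-replicate-zero m))
  where
  outside : ∀ (v : Fin m) → indicator (inRange? 0 0 (suc (toℕ v))) ≡ 0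
  outside v = indicator-no (inRange? 0 0 (suc (toℕ v))) λ { (_ , ()) }
countRange (suc m) zero (suc hi) _ (s≤s hi<m) =
  cong₂ _+_ (indicator-yes (inRange? 0 (suc hi) 0) (z≤n , z≤n))
            (trans (sum-cong-≗ shift) (countRange m zero hi z≤n hi<m))
  where
  shift : ∀ (v : Fin m) →
          indicator (inRange? 0 (suc hi) (suc (toℕ v))) ≡ indicator (inRange? 0 hi (toℕ v))
  shift v = indicator-⇔ (inRange? 0 (suc hi) (suc (toℕ v))) (inRange? 0 hi (toℕ v))
              (mk⇔ (λ (_ , h) → z≤n , s≤s⁻¹ h) (λ (_ , h) → z≤n , s≤s h))
countRange (suc m) (suc lo) (suc hi) (s≤s lo≤hi) (s≤s hi<m) =
  cong₂ _+_ (indicator-no (inRange? (suc lo) (suc hi) 0) λ { (() , _) })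
            (trans (sum-cong-≗ shift) (countRange m lo hi lo≤hi hi<m))
  where
  shift : ∀ (v : Fin m) → indicator (inRange? (suc lo) (suc hi) (suc (toℕ v))) ≡
                           indicator (inRange? lo hi (toℕ v))
  shift v = indicator-⇔ (inRange? (suc lo) (suc hi) (suc (toℕ v))) (inRange? lo hi (toℕ v))
              (mk⇔ (λ (l , h) → s≤s⁻¹ l , s≤s⁻¹ h) (λ (l , h) → s≤s l , s≤s h))

module PermutationWindows {n} (π : Perm n) where
  open Inverse π using (strictlyInverseˡ; strictlyInverseʳ) renaming (to to π→; from to π←)

  σ : Fin n → ℕ
  σ p = π ⟨ p ⟩

  σ-injective : ∀ {x y} → σ x ≡ σ y → x ≡ y
  σ-injective {x} {y} eq = begin
    x           ≡⟨ strictlyInverseʳ x ⟨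
    π← (π→ x)   ≡⟨ cong π← (toℕ-injective eq) ⟩
    π← (π→ y)   ≡⟨ strictlyInverseʳ y ⟩
    y           ∎
    where open ≡-Reasoning

  σ<n : ∀ x → σ x < n
  σ<n x = toℕ<n (π→ x)

  module _ (w : Window σ) where
    open Window w

    -- The positions and the values of a window are equally many: count the
    -- positions in [first, last], and their values, re-indexing by π.
    sameLength : last ∸ first ≡ high ∸ low
    sameLength = suc-injective (begin
      suc (last ∸ first)   ≡⟨ +-∸-assoc 1 (<⇒≤ first<last) ⟨
      suc last ∸ first     ≡⟨ countRange n first last (<⇒≤ first<last) last<n ⟨
      sum {n} (λ p → indicator (inRange? first last (toℕ p)))
        ≡⟨ sum-cong-≗ (λ p → indicator-⇔ _ _ (exact p)) ⟩
      sum {n} (λ p → indicator (inRange? low high (toℕ (π→ p))))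
        ≡⟨ ∑-permute (λ v → indicator (inRange? low high (toℕ v))) π ⟨
      sum {n} (λ v → indicator (inRange? low high (toℕ v)))
        ≡⟨ countRange n low high low≤high high<n ⟩
      suc high ∸ low       ≡⟨ +-∸-assoc 1 low≤high ⟩
      suc (high ∸ low)     ∎)
      where open ≡-Reasoning

    high≡ : low + (last ∸ first) ≡ high
    high≡ = trans (cong (low +_) sameLength) (m+[n∸m]≡n low≤high)

    valueAt : ∀ v → low ≤ v × v ≤ low + (last ∸ first) →
              ∃[ p ] (first ≤ toℕ p × toℕ p ≤ last × π ⟨ p ⟩ ≡ v)
    valueAt v (low≤v , v≤) = p , first≤p , p≤last , σp≡v
      where
      v<n : v < n
      v<n = ≤-<-trans (subst (v ≤_) high≡ v≤) high<n
      p : Fin n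
      p = π← (fromℕ< v<n)
      σp≡v : σ p ≡ v
      σp≡v = trans (cong toℕ (strictlyInverseˡ (fromℕ< v<n))) (toℕ-fromℕ< v<n)
      first≤p×p≤last : first ≤ toℕ p × toℕ p ≤ last
      first≤p×p≤last = Equivalence.from (exact p)
        (subst (low ≤_) (sym σp≡v) low≤v , subst₂ _≤_ (sym σp≡v) high≡ v≤)
      first≤p : first ≤ toℕ p
      first≤p = proj₁ first≤p×p≤last
      p≤last : toℕ p ≤ last
      p≤last = proj₂ first≤p×p≤last

    interval : IsInterval π first last
    interval = <⇒≤ first<last , last<n , low , λ v → mk⇔
      (λ (p , first≤p , p≤last , σp≡v) → let (l , h) = Equivalence.to (exact p) (first≤p , p≤last) in
         subst (low ≤_) σp≡v l , subst₂ _≤_ σp≡v (sym high≡) h)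
      (valueAt v)

    notSimple : Simple π → ⊥
    notSimple simple with simple first last interval
    ... | inj₁ len≡1 = <⇒≢ (m<n⇒0<n∸m first<last)
                            (sym (suc-injective (trans (+-comm 1 (last ∸ first)) len≡1)))
    ... | inj₂ len≡n = tooLong proper
      where
      n≡ : n ≡ suc (last ∸ first)
      n≡ = trans (sym len≡n) (+-comm (last ∸ first) 1)
      tooLong : 0 < first ⊎ suc last < n → ⊥
      tooLong (inj₁ 0<first) =
        <⇒≱ last<n (subst (_≤ last) (sym n≡) (∸-monoʳ-< 0<first (<⇒≤ first<last)))
      tooLong (inj₂ suc[last]<n) =
        <⇒≱ suc[last]<n (subst (_≤ suc last) (sym n≡) (s≤s (m∸n≤m last first)))

-- A pattern whose value at index a is
-- 1 + rank a occurs in π at positions f as soon as f is increasing at each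
-- consecutive step and the values of π at f (byValue 0), f (byValue 1), …
-- increase at each step, where byValue lists the indices by increasing rank.
module Occurrences {n} (π : Perm n) where

  occurrence : (k : ℕ) (v : Fin (suc k) → ℕ) (byValue rank : Fin (suc k) → Fin (suc k)) →
    (∀ a → byValue (rank a) ≡ a) → (∀ a → v a ≡ suc (toℕ (rank a))) →
    (f : Fin (suc k) → Fin n) → (∀ i → f (inject₁ i) <ᶠ f (suc i)) →
    (∀ i → π ⟨ f (byValue (inject₁ i)) ⟩ < π ⟨ f (byValue (suc i)) ⟩) →
    Contains π (pat (suc k) v)
  occurrence k v byValue rank byValue∘rank v≡rank f posSteps valSteps =
    f , increasing (toℕ ∘ f) posSteps , λ a b → mk⇔ (reflect a b) (preserve a b)
    where
    preserve : ∀ a b → v a < v b → π ⟨ f a ⟩ < π ⟨ f b ⟩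
    preserve a b va<vb = subst₂ (λ x y → π ⟨ f x ⟩ < π ⟨ f y ⟩) (byValue∘rank a) (byValue∘rank b)
      (increasing (λ r → π ⟨ f (byValue r) ⟩) valSteps (rank a) (rank b)
                  (s≤s⁻¹ (subst₂ _<_ (v≡rank a) (v≡rank b) va<vb)))

    v-injective : ∀ a b → v a ≡ v b → a ≡ b
    v-injective a b eq = begin
      a                  ≡⟨ byValue∘rank a ⟨
      byValue (rank a)   ≡⟨ cong byValue (toℕ-injective (suc-injective
                              (trans (sym (v≡rank a)) (trans eq (v≡rank b))))) ⟩
      byValue (rank b)   ≡⟨ byValue∘rank b ⟩
      b                  ∎
      where open ≡-Reasoning

    reflect : ∀ a b → π ⟨ f a ⟩ < π ⟨ f b ⟩ → v a < v b
    reflect a b lt with <-cmp (v a) (v b)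
    ... | tri< va<vb _ _ = va<vb
    ... | tri≈ _ eq _ = ⊥-elim (<-irrefl (cong (λ x → π ⟨ f x ⟩) (v-injective a b eq)) lt)
    ... | tri> _ _ vb<va = ⊥-elim (<-asym lt (preserve b a vb<va))

  positions4 : (i j k l : Fin n) → Fin 4 → Fin n
  positions4 i j k l = λ { 0F → i ; 1F → j ; 2F → k ; 3F → l }

  -- Avoiding 2143 and 3142 rules out dominated descents: i j k l is an
  -- occurrence of 2143 or of 3142 according as σ i < σ l or σ l < σ i.
  noDominatedDescents : Avoids π p2143 → Avoids π p3142 → NoDominatedDescents (π ⟨_⟩)
  noDominatedDescents av2143 av3142 i j k l i<j j<k k<l σj<σi σl<σk σi<σk σj<σl
    with <-cmp (π ⟨ i ⟩) (π ⟨ l ⟩)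
  ... | tri< σi<σl _ _ = av2143 (occurrence 3 (val p2143) swaps swaps swaps² swaps-rank
                                   (positions4 i j k l) (λ { 0F → i<j ; 1F → j<k ; 2F → k<l })
                                   (λ { 0F → σj<σi ; 1F → σi<σl ; 2F → σl<σk }))
    where
    swaps : Fin 4 → Fin 4
    swaps = λ { 0F → 1F ; 1F → 0F ; 2F → 3F ; 3F → 2F }
    swaps² : ∀ a → swaps (swaps a) ≡ a
    swaps² = λ { 0F → refl ; 1F → refl ; 2F → refl ; 3F → refl }
    swaps-rank : ∀ a → val p2143 a ≡ suc (toℕ (swaps a))
    swaps-rank = λ { 0F → refl ; 1F → refl ; 2F → refl ; 3F → refl }
  ... | tri≈ _ eq _ =
    <-irrefl (cong toℕ (PermutationWindows.σ-injective π eq)) (<-trans i<j (<-trans j<k k<l))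
  ... | tri> _ _ σl<σi = av3142 (occurrence 3 (val p3142) byValue rank byValue∘rank rank-val
                                   (positions4 i j k l) (λ { 0F → i<j ; 1F → j<k ; 2F → k<l })
                                   (λ { 0F → σj<σl ; 1F → σl<σi ; 2F → σi<σk }))
    where
    byValue rank : Fin 4 → Fin 4
    byValue = λ { 0F → 1F ; 1F → 3F ; 2F → 0F ; 3F → 2F }
    rank = λ { 0F → 2F ; 1F → 0F ; 2F → 3F ; 3F → 1F }
    byValue∘rank : ∀ a → byValue (rank a) ≡ a
    byValue∘rank = λ { 0F → refl ; 1F → refl ; 2F → refl ; 3F → refl }
    rank-val : ∀ a → val p3142 a ≡ suc (toℕ (rank a))
    rank-val = λ { 0F → refl ; 1F → refl ; 2F → refl ; 3F → refl }

  occurrence246135 : ∀ x a b c d y → x <ᶠ a → a <ᶠ b → b <ᶠ c → c <ᶠ d → d <ᶠ y →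
    π ⟨ c ⟩ < π ⟨ x ⟩ → π ⟨ x ⟩ < π ⟨ d ⟩ → π ⟨ d ⟩ < π ⟨ a ⟩ →
    π ⟨ a ⟩ < π ⟨ y ⟩ → π ⟨ y ⟩ < π ⟨ b ⟩ → Contains π p246135
  occurrence246135 x a b c d y x<a a<b b<c c<d d<y σc<σx σx<σd σd<σa σa<σy σy<σb =
    occurrence 5 (val p246135) byValue rank byValue∘rank rank-val
      (λ { 0F → x ; 1F → a ; 2F → b ; 3F → c ; 4F → d ; 5F → y })
      (λ { 0F → x<a ; 1F → a<b ; 2F → b<c ; 3F → c<d ; 4F → d<y })
      (λ { 0F → σc<σx ; 1F → σx<σd ; 2F → σd<σa ; 3F → σa<σy ; 4F → σy<σb })
    where
    byValue rank : Fin 6 → Fin 6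
    byValue = λ { 0F → 3F ; 1F → 0F ; 2F → 4F ; 3F → 1F ; 4F → 5F ; 5F → 2F }
    rank = λ { 0F → 1F ; 1F → 3F ; 2F → 5F ; 3F → 0F ; 4F → 2F ; 5F → 4F }
    byValue∘rank : ∀ a → byValue (rank a) ≡ a
    byValue∘rank = λ { 0F → refl ; 1F → refl ; 2F → refl ; 3F → refl ; 4F → refl ; 5F → refl }
    rank-val : ∀ a → val p246135 a ≡ suc (toℕ (rank a))
    rank-val = λ { 0F → refl ; 1F → refl ; 2F → refl ; 3F → refl ; 4F → refl ; 5F → refl }

  -- 246135 contains 3412 as its factor 4613.
  contains3412 : Contains π p246135 → Contains π p3412
  contains3412 (f , increasing-f , order) =
    occurrence 3 (val p3412) swapHalves swapHalves swapHalves² swapHalves-rank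
      (positions4 (f 1F) (f 2F) (f 3F) (f 4F))
      (λ { 0F → increasing-f 1F 2F (n<1+n 1) ; 1F → increasing-f 2F 3F (n<1+n 2)
         ; 2F → increasing-f 3F 4F (n<1+n 3) })
      (λ { 0F → below 3F 4F _ ; 1F → below 4F 1F _ ; 2F → below 1F 2F _ })
    where
    below : ∀ a b → T (val p246135 a <ᵇ val p246135 b) → π ⟨ f a ⟩ < π ⟨ f b ⟩
    below a b lt = Equivalence.from (order a b) (<ᵇ⇒< _ _ lt)
    swapHalves : Fin 4 → Fin 4
    swapHalves = λ { 0F → 2F ; 1F → 3F ; 2F → 0F ; 3F → 1F }
    swapHalves² : ∀ a → swapHalves (swapHalves a) ≡ a
    swapHalves² = λ { 0F → refl ; 1F → refl ; 2F → refl ; 3F → refl }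
    swapHalves-rank : ∀ a → val p3412 a ≡ suc (toℕ (swapHalves a))
    swapHalves-rank = λ { 0F → refl ; 1F → refl ; 2F → refl ; 3F → refl }

module Avoidance {m} (π : Perm (suc m)) (simple : Simple π)
  (av2143 : Avoids π p2143) (av3142 : Avoids π p3142) (av246135 : Avoids π p246135) where
  open PermutationWindows π using (σ; σ-injective; σ<n; notSimple)
  open Occurrences π using (noDominatedDescents; occurrence246135)

  noDD : NoDominatedDescents σ
  noDD = noDominatedDescents av2143 av3142

  IsFour : Fin (suc m) → Set
  IsFour j = ∃[ i ] ∃[ k ] ∃[ l ] Is3412 σ i j k l

  isFour? : Decidable IsFour
  isFour? j = any? λ i → any? λ k → any? λ l → is3412? σ i j k l

  IsOneWith : Fin (suc m) → Fin (suc m) → Set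
  IsOneWith j k = ∃[ i ] ∃[ l ] Is3412 σ i j k l

  isOneWith? : ∀ j → Decidable (IsOneWith j)
  isOneWith? j k = any? λ i → any? λ l → is3412? σ i j k l

  -- An occurrence a b c d with the highest "4" overall, and the lowest "1"
  -- among those with "4" at b, is impossible: values between σ c and σ d
  -- before a together with values between σ a and σ b after d would give
  -- 246135, and if either kind is missing σ has a window.
  extremalOccurrence⊥ : ∀ a b c d → Is3412 σ a b c d →
    (∀ j → IsFour j → σ j ≤ σ b) → (∀ k → IsOneWith b k → σ c ≤ σ k) → ⊥
  extremalOccurrence⊥ a b c d abcd b-highest c-lowest =
    fills (any? λ x → (toℕ x <? toℕ a) ×-dec (σ c <? σ x) ×-dec (σ x <? σ d))
          (any? λ y → (toℕ d <? toℕ y) ×-dec (σ a <? σ y) ×-dec (σ y <? σ b))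
    where
    open Is3412 abcd
    fills : Dec (∃[ x ] (x <ᶠ a × σ c < σ x × σ x < σ d)) →
            Dec (∃[ y ] (d <ᶠ y × σ a < σ y × σ y < σ b)) → ⊥
    fills (yes (x , x<a , σc<σx , σx<σd)) (yes (y , d<y , σa<σy , σy<σb)) =
      av246135 (occurrence246135 x a b c d y x<a a<b b<c c<d d<y σc<σx σx<σd σd<σa σa<σy σy<σb)
    fills (no noLeftFill) _ = notSimple (RightWindow.window σ σ-injective σ<n noDD a b c d abcd
      (λ i k l o → c-lowest k (i , l , o))
      (λ x x<a σc<σx σx<σd → noLeftFill (x , x<a , σc<σx , σx<σd))) simple
    fills _ (no noRightFill) = notSimple (ReverseComplement.leftWindow σ σ-injective σ<n noDD
      a b c d abcd
      (λ i j l o → b-highest j (i , c , l , o))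
      (λ y d<y σa<σy σy<σb → noRightFill (y , d<y , σa<σy , σy<σb))) simple

  avoids3412 : Avoids π p3412
  avoids3412 (f , increasing-f , order) = extremalOccurrence⊥ a b c d abcd
    (Maximal.bound highestFour) (Minimal.bound lowestOne)
    where
    later : ∀ i j → T (toℕ i <ᵇ toℕ j) → f i <ᶠ f j
    later i j lt = increasing-f i j (<ᵇ⇒< _ _ lt)
    below : ∀ i j → T (val p3412 i <ᵇ val p3412 j) → σ (f i) < σ (f j)
    below i j lt = Equivalence.from (order i j) (<ᵇ⇒< _ _ lt)

    highestFour : Maximal σ IsFour
    highestFour = argmax σ isFour? (f 1F) (f 0F , f 2F , f 3F ,
      occ3412 (later 0F 1F _) (later 1F 2F _) (later 2F 3F _)
              (below 2F 3F _) (below 3F 0F _) (below 0F 1F _))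
    b : Fin (suc m)
    b = Maximal.point highestFour

    lowestOne : Minimal σ (IsOneWith b)
    lowestOne = let (i , k , l , o) = Maximal.holds highestFour in
                argmin σ (isOneWith? b) k (i , l , o)
    c a d : Fin (suc m)
    c = Minimal.point lowestOne
    a = proj₁ (Minimal.holds lowestOne)
    d = proj₁ (proj₂ (Minimal.holds lowestOne))
    abcd : Is3412 σ a b c d
    abcd = proj₂ (proj₂ (Minimal.holds lowestOne))

simple⇒avoids3412 : ∀ n (π : Perm n) → Simple π →
  Avoids π p2143 → Avoids π p3142 → Avoids π p246135 → Avoids π p3412
simple⇒avoids3412 zero π _ _ _ _ (f , _) = case f 0F of λ ()
simple⇒avoids3412 (suc m) π = Avoidance.avoids3412 π

lemma2p3 : (n : ℕ) (π : Perm n) →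
    (Simple π × AvoidsAll π (p2143 ∷ p3142 ∷ p246135 ∷ [])) ⇔
    (Simple π × AvoidsAll π (p2143 ∷ p3142 ∷ p3412 ∷ []))
lemma2p3 n π = mk⇔
  (λ { (simple , av2143 ∷ av3142 ∷ av246135 ∷ []) →
         simple , av2143 ∷ av3142 ∷ simple⇒avoids3412 n π simple av2143 av3142 av246135 ∷ [] })
  (λ { (simple , av2143 ∷ av3142 ∷ av3412 ∷ []) →
         simple , av2143 ∷ av3142 ∷ (av3412 ∘ Occurrences.contains3412 π) ∷ [] })
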